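{- Let $G$ be a graph having a chordal vertex deletion set of size $k$ and let $w:V(G)\to\mathbb{R}_{\ge 0}$ be a weight function. Then there exists a $\frac{2}{3}$-balanced separation $(A,B)$ of $G$ with respect to $w$ such that $G[A\cap B]$ is a $(1,k)$-semi clique.
   Context: A chordal vertex deletion set of $G$ is a set $S\subseteq V(G)$ such that $G-S$ is chordal (has no induced cycle of length at least $4$). For $A,B\subseteq V(G)$, a set $C$ is a separator of $A$ and $B$ if every path from a vertex of $A$ to a vertex of $B$ contains a vertex of $C$. A pair $(A,B)$ of vertex subsets is a separation of $G$ if $A\cup B=V(G)$ and $A\cap B$ is a separator of $A\setminus B$ and $B\setminus A$. For $0<\alpha<1$, a separation $(A,B)$ is $\alpha$-balanced with respect to $w$ if $w(A\setminus B)\le \alpha\, w(V(G))$ and $w(B\setminus A)\le\alpha\, w(V(G))$, where $w(D)=\sum_{x\in D}w(x)$. A graph $H$ is a $(c,\ell)$-semi clique if there is a partition $C\uplus N$ of $V(H)$ such that $H[C]$ is a union of at most $c$ cliques and $|N|\le\ell$.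
   Formalization: The weight function w takes values in the nonnegative rationals instead of the nonnegative reals. -}

module Defs where

open import Data.Nat as ℕ using (ℕ; suc; _%_)
open import Data.Fin using (Fin; toℕ; inject₁; suc)
open import Data.Fin.Subset using (Subset; _∈_; _∉_; _∩_; _∪_; _─_; ∣_∣; ⊤)
open import Data.Vec using (lookup)
open import Data.Bool using (Bool; true; false; if_then_else_)
open import Data.Rational using (ℚ; 0ℚ; _+_; _*_; _≤_)
open import Data.Product using (Σ; ∃; ∃-syntax; _×_; _,_)
open import Data.Sum using (_⊎_)
open import Function.Definitions using (Injective)
open import Function.Bundles using (_⇔_)
open import Relation.Binary.PropositionalEquality using (_≡_; _≢_)
open import Relation.Nullary using (¬_)

record Graph (n : ℕ) : Set where
  field
    Adj   : Fin n → Fin n → Bool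
    sym   : ∀ u v → Adj u v ≡ Adj v u
    irrefl : ∀ v → Adj v v ≡ false
open Graph public

Adjacent : ∀ {n} → Graph n → Fin n → Fin n → Set
Adjacent G u v = Adj G u v ≡ true

CycNeighbours : ∀ {m} → Fin m → Fin m → Set
CycNeighbours {suc m} i j = (toℕ j ≡ (suc (toℕ i)) % suc m) ⊎ (toℕ i ≡ (suc (toℕ j)) % suc m)

InducedCycleAvoiding : ∀ {n} → Graph n → Subset n → (m : ℕ) → (Fin m → Fin n) → Set
InducedCycleAvoiding {n} G S m c =
  4 ℕ.≤ m × Injective _≡_ _≡_ c × (∀ i → c i ∉ S) ×
  (∀ i j → Adjacent G (c i) (c j) ⇔ CycNeighbours i j)

ChordalDeletionSet : ∀ {n} → Graph n → Subset n → Set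
ChordalDeletionSet G S = ∀ m c → ¬ InducedCycleAvoiding G S m c

IsPath : ∀ {n} → Graph n → (m : ℕ) → (Fin (suc m) → Fin n) → Set
IsPath G m p = Injective _≡_ _≡_ p × (∀ (i : Fin m) → Adjacent G (p (inject₁ i)) (p (suc i)))

Separates : ∀ {n} → Graph n → Subset n → Subset n → Subset n → Set
Separates G C A B = ∀ m p → IsPath G m p → p Data.Fin.zero ∈ A → p (Data.Fin.fromℕ m) ∈ B →
  ∃[ i ] p i ∈ C

IsSeparation : ∀ {n} → Graph n → Subset n → Subset n → Set
IsSeparation G A B = (∀ v → v ∈ A ⊎ v ∈ B) × Separates G (A ∩ B) (A ─ B) (B ─ A)

weight : ∀ {n} → (Fin n → ℚ) → Subset n → ℚ
weight {ℕ.zero} w D = 0ℚ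
weight {suc n} w D =
  (if lookup D Data.Fin.zero then w Data.Fin.zero else 0ℚ)
  + weight (λ i → w (suc i)) (Data.Vec.tail D)

Balanced : ∀ {n} → ℚ → (Fin n → ℚ) → Subset n → Subset n → Set
Balanced α w A B = weight w (A ─ B) ≤ α * weight w ⊤ × weight w (B ─ A) ≤ α * weight w ⊤

-- The induced subgraph G[X] is a (c , ℓ)-semi clique: X = C ⊎ N (disjoint),
-- G[C] is a (disjoint) union of at most c cliques (witnessed by a labelling
-- f of C with c labels such that distinct u, v ∈ C are adjacent iff they
-- have the same label), and |N| ≤ ℓ.
IsSemiClique : ∀ {n} → ℕ → ℕ → Graph n → Subset n → Set
IsSemiClique {n} c ℓ G X =
  Σ (Subset n) λ C → Σ (Subset n) λ N →
    (∀ v → v ∈ X ⇔ (v ∈ C ⊎ v ∈ N)) × (∀ v → v ∈ C → v ∉ N) ×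
    (Σ (Fin n → Fin c) λ f → ∀ u v → u ∈ C → v ∈ C → u ≢ v →
       Adjacent G u v ⇔ (f u ≡ f v)) ×
    ∣ N ∣ ℕ.≤ ℓ

{-# OPTIONS --safe #-}
module Submission where

-- Keep a clique K of G - S and a union D of components of G - (S ∪ K)
-- with w(D) > 2/3 w(V). If D is disconnected, pass to a heavier part of it. If D is
-- connected, some v ∈ D is adjacent to every vertex of K having a neighbour in D: start
-- from any v and, while some such x misses v, replace v by the neighbour u of x nearest
-- to v in G[D]; a vertex of K adjacent to v but not to u would close an induced cycle of
-- length ≥ 4 with x and a shortest u-v path. Then discard from K the vertices without a
-- neighbour in D and move v from D into K. As D shrinks, eventually w(D) ≤ 2/3 w(V) while
-- S ∪ K ∪ D still weighs at least w(V)/3; then (S ∪ K ∪ D, V ∖ D) is the separation, and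
-- its separator S ∪ K is a clique plus |S| vertices.

open import Defs hiding (sym)
open import Algebra.Bundles using (CommutativeMonoid)
import Algebra.Properties.CommutativeSemigroup as CommutativeSemigroupProperties
open import Data.Bool using (true; if_then_else_) renaming (_≟_ to _≟ᵇ_)
open import Data.Bool.Properties using (T-≡)
open import Data.Empty using (⊥-elim)
open import Data.Fin as F using (Fin; toℕ; inject₁; fromℕ)
import Data.Fin.Properties as FP
open import Data.Fin.Subset
open import Data.Fin.Subset.Induction using (⊂-wellFounded; ⊃-wellFounded)
open import Data.Fin.Subset.Properties
open import Data.Integer using (+_)
open import Data.Nat as ℕ using (ℕ; zero; suc; z≤n; s≤s; _∸_; _%_)
open import Data.Nat.DivMod using (m<n⇒m%n≡m; n%n≡0)
import Data.Nat.Properties as ℕ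
open import Data.Product using (Σ; ∃-syntax; _×_; _,_; proj₁; proj₂)
open import Data.Rational using (ℚ; 0ℚ; _≤_; _<_; _/_)
open import Data.Sum using (_⊎_; inj₁; inj₂; [_,_]′; map₂; swap)
open import Data.Vec using (_∷_; []; tabulate; here; there)
open import Data.Vec.Properties using (lookup∘tabulate; []=⇒lookup; lookup⇒[]=)
open import Function using (_∘_)
open import Function.Bundles using (Equivalence; mk⇔)
open import Induction.WellFounded using (Acc; acc)
open import Relation.Binary.Definitions using (tri<; tri≈; tri>)
open import Relation.Binary.PropositionalEquality
  using (_≡_; _≢_; refl; sym; trans; cong; subst; subst₂; module ≡-Reasoning)
open import Relation.Nullary using (¬_; Dec; yes; no; _×-dec_)
open import Relation.Nullary.Decidable using (⌊_⌋; toWitness; fromWitness)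
open import Relation.Unary using (Pred; Decidable)

private
  variable
    n : ℕ

select : ∀ {ℓ} {P : Pred (Fin n) ℓ} → Decidable P → Subset n
select P? = tabulate (λ x → ⌊ P? x ⌋)

module _ {ℓ} {P : Pred (Fin n) ℓ} {P? : Decidable P} {x : Fin n} where

  ∈-select⁺ : P x → x ∈ select P?
  ∈-select⁺ px = lookup⇒[]= x _
    (trans (lookup∘tabulate _ x) (Equivalence.to T-≡ (fromWitness {a? = P? x} px)))

  ∈-select⁻ : x ∈ select P? → P x
  ∈-select⁻ x∈ = toWitness {a? = P? x}
    (Equivalence.from T-≡ (trans (sym (lookup∘tabulate _ x)) ([]=⇒lookup x∈)))

x∈p─q⇒x∉q : ∀ {x : Fin n} (p q : Subset n) → x ∈ p ─ q → x ∉ q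
x∈p─q⇒x∉q (_ ∷ p) (_ ∷ q) (there x∈) (there x∈q) = x∈p─q⇒x∉q p q x∈ x∈q
x∈p─q⇒x∉q (inside ∷ p) (inside ∷ q) () here
x∈p─q⇒x∉q (outside ∷ p) (inside ∷ q) () here

⊈⇒witness : ∀ {p q : Subset n} → p ⊈ q → ∃[ x ] x ∈ p × x ∉ q
⊈⇒witness {p = p} {q} p⊈q with nonempty? (p ─ q)
... | yes (x , x∈p─q) = x , p─q⊆p p q x∈p─q , x∈p─q⇒x∉q p q x∈p─q
... | no p─q-empty = ⊥-elim (p⊈q p⊆q)
  where
  p⊆q : p ⊆ q
  p⊆q {x} x∈p with x ∈? q
  ... | yes x∈q = x∈q
  ... | no x∉q = ⊥-elim (p─q-empty (x , x∈p∧x∉q⇒x∈p─q x∈p x∉q))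

increasing-stabilises : (f : ℕ → Subset n) → (∀ i → f i ⊆ f (suc i)) → ∃[ j ] f (suc j) ⊆ f j
increasing-stabilises f grows = go 0 (⊃-wellFounded (f 0))
  where
  go : ∀ i → Acc _⊃_ (f i) → ∃[ j ] f (suc j) ⊆ f j
  go i (acc later) with f i ⊂? f (suc i)
  ... | yes fi⊂ = go (suc i) (later fi⊂)
  ... | no fi⊄ = i , stuck
    where
    stuck : f (suc i) ⊆ f i
    stuck {x} x∈ with x ∈? f i
    ... | yes x∈fi = x∈fi
    ... | no x∉fi = ⊥-elim (fi⊄ (grows i , x , x∈ , x∉fi))

increasing⇒monotone : (f : ℕ → Subset n) → (∀ i → f i ⊆ f (suc i)) → ∀ {i j} → i ℕ.≤ j → f i ⊆ f j
increasing⇒monotone f grows i≤j = go (ℕ.≤⇒≤′ i≤j)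
  where
  go : ∀ {i j} → i ℕ.≤′ j → f i ⊆ f j
  go ℕ.≤′-refl = λ x∈ → x∈
  go (ℕ.≤′-step i≤′j) = λ x∈ → grows _ (go i≤′j x∈)

least-witness : ∀ {ℓ} {P : Pred ℕ ℓ} → Decidable P → ∀ {t} → P t →
  ∃[ s ] P s × (∀ {i} → i ℕ.< s → ¬ P i)
least-witness P? {zero} p0 = 0 , p0 , λ ()
least-witness {P = P} P? {suc t} pt with P? 0
... | yes p0 = 0 , p0 , λ ()
... | no ¬p0 with least-witness (λ i → P? (suc i)) pt
...   | s , ps , below = suc s , ps , below′
  where
  below′ : ∀ {i} → i ℕ.< suc s → ¬ P i
  below′ {zero} _ = ¬p0
  below′ {suc i} (s≤s i<s) = below i<s

module _ where
  open import Data.Rational using (_+_; _*_)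
  open import Data.Rational.Properties

  weight-─ : (w : Fin n → ℚ) {p q : Subset n} → q ⊆ p → weight w p ≡ weight w q + weight w (p ─ q)
  weight-─ {zero} w {[]} {[]} _ = sym (+-identityˡ 0ℚ)
  weight-─ {suc n} w {a ∷ p} {inside ∷ q} q⊆p with q⊆p here
  ... | here = begin
    w₀ + weight w′ p                              ≡⟨ cong (λ z → w₀ + z) (weight-─ w′ (drop-∷-⊆ q⊆p)) ⟩
    w₀ + (weight w′ q + weight w′ (p ─ q))        ≡⟨ sym (+-assoc w₀ _ _) ⟩
    (w₀ + weight w′ q) + weight w′ (p ─ q)        ≡⟨ cong (λ z → (w₀ + weight w′ q) + z) (sym (+-identityˡ _)) ⟩
    (w₀ + weight w′ q) + (0ℚ + weight w′ (p ─ q)) ∎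
    where
    open ≡-Reasoning
    w₀ : ℚ
    w₀ = w F.zero
    w′ : Fin n → ℚ
    w′ i = w (F.suc i)
  weight-─ {suc n} w {a ∷ p} {outside ∷ q} q⊆p = begin
    h + weight w′ p                               ≡⟨ cong (λ z → h + z) (weight-─ w′ (drop-∷-⊆ q⊆p)) ⟩
    h + (weight w′ q + weight w′ (p ─ q))         ≡⟨ x∙yz≈y∙xz h (weight w′ q) (weight w′ (p ─ q)) ⟩
    weight w′ q + (h + weight w′ (p ─ q))
      ≡⟨ cong (_+ (h + weight w′ (p ─ q))) (sym (+-identityˡ (weight w′ q))) ⟩
    (0ℚ + weight w′ q) + (h + weight w′ (p ─ q))  ∎
    where
    open ≡-Reasoning
    open CommutativeSemigroupProperties (CommutativeMonoid.commutativeSemigroup +-0-commutativeMonoid)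
      using (x∙yz≈y∙xz)
    h : ℚ
    h = if a then w F.zero else 0ℚ
    w′ : Fin n → ℚ
    w′ i = w (F.suc i)

  weight-mono : (w : Fin n → ℚ) → (∀ v → 0ℚ ≤ w v) → {p q : Subset n} → p ⊆ q → weight w p ≤ weight w q
  weight-mono {zero} w w≥0 {[]} {[]} _ = ≤-refl
  weight-mono {suc n} w w≥0 {a ∷ p} {b ∷ q} p⊆q =
    +-mono-≤ (head a b p⊆q) (weight-mono (λ i → w (F.suc i)) (λ i → w≥0 (F.suc i)) (drop-∷-⊆ p⊆q))
    where
    head : ∀ a b → (F.zero ∈ a ∷ p → F.zero ∈ b ∷ q) →
      (if a then w F.zero else 0ℚ) ≤ (if b then w F.zero else 0ℚ)
    head inside inside _ = ≤-refl
    head inside outside zero∈ with zero∈ here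
    ... | ()
    head outside inside _ = w≥0 F.zero
    head outside outside _ = ≤-refl

  weight-⊥ : (w : Fin n → ℚ) → weight w ⊥ ≡ 0ℚ
  weight-⊥ {zero} w = refl
  weight-⊥ {suc n} w = trans (+-identityˡ _) (weight-⊥ (λ i → w (F.suc i)))

  weight-nonneg : (w : Fin n → ℚ) → (∀ v → 0ℚ ≤ w v) → ∀ p → 0ℚ ≤ weight w p
  weight-nonneg w w≥0 p = subst (_≤ weight w p) (weight-⊥ w) (weight-mono w w≥0 (⊆-min p))

  ⅓ ⅔ : ℚ → ℚ
  ⅓ W = + 1 / 3 * W
  ⅔ W = + 2 / 3 * W

  ⅔+⅓ : ∀ W → ⅔ W + ⅓ W ≡ W
  ⅔+⅓ W = trans (sym (*-distribʳ-+ W (+ 2 / 3) (+ 1 / 3))) (*-identityˡ W)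

  ⅓+⅓ : ∀ W → ⅓ W + ⅓ W ≡ ⅔ W
  ⅓+⅓ W = sym (*-distribʳ-+ W (+ 1 / 3) (+ 1 / 3))

  ⅓-nonneg : ∀ {W} → 0ℚ ≤ W → 0ℚ ≤ ⅓ W
  ⅓-nonneg {W} W≥0 = subst (_≤ ⅓ W) (*-zeroʳ (+ 1 / 3)) (*-monoˡ-≤-nonNeg (+ 1 / 3) W≥0)

  ⅓≤⅔ : ∀ {W} → 0ℚ ≤ W → ⅓ W ≤ ⅔ W
  ⅓≤⅔ {W} W≥0 = begin
    ⅓ W        ≡⟨ sym (+-identityʳ (⅓ W)) ⟩
    ⅓ W + 0ℚ   ≤⟨ +-monoʳ-≤ (⅓ W) (⅓-nonneg W≥0) ⟩
    ⅓ W + ⅓ W  ≡⟨ ⅓+⅓ W ⟩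
    ⅔ W        ∎
    where open ≤-Reasoning

  ⅓≤id : ∀ {W} → 0ℚ ≤ W → ⅓ W ≤ W
  ⅓≤id {W} W≥0 = begin
    ⅓ W        ≡⟨ sym (+-identityˡ (⅓ W)) ⟩
    0ℚ + ⅓ W   ≤⟨ +-monoˡ-≤ (⅓ W) (≤-trans (⅓-nonneg W≥0) (⅓≤⅔ W≥0)) ⟩
    ⅔ W + ⅓ W  ≡⟨ ⅔+⅓ W ⟩
    W          ∎
    where open ≤-Reasoning

  below-⅔-beside-⅓ : ∀ W {a b} → a + b ≤ W → ⅓ W ≤ b → a ≤ ⅔ W
  below-⅔-beside-⅓ W {a} {b} a+b≤W ⅓≤b with a ≤? ⅔ W
  ... | yes a≤⅔ = a≤⅔
  ... | no a≰⅔ = ⊥-elim (<-irrefl refl (begin-strict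
    W          ≡⟨ sym (⅔+⅓ W) ⟩
    ⅔ W + ⅓ W  <⟨ +-mono-<-≤ (≰⇒> a≰⅔) ⅓≤b ⟩
    a + b      ≤⟨ a+b≤W ⟩
    W          ∎))
    where open ≤-Reasoning

  heavier-part : ∀ W {a b} → ⅔ W < a + b → b ≤ a → ⅓ W ≤ a
  heavier-part W {a} {b} ⅔<a+b b≤a with ⅓ W ≤? a
  ... | yes ⅓≤a = ⅓≤a
  ... | no ⅓≰a = ⊥-elim (<-irrefl refl (begin-strict
    ⅔ W        <⟨ ⅔<a+b ⟩
    a + b      ≤⟨ +-monoʳ-≤ a b≤a ⟩
    a + a      <⟨ +-mono-< (≰⇒> ⅓≰a) (≰⇒> ⅓≰a) ⟩
    ⅓ W + ⅓ W  ≡⟨ ⅓+⅓ W ⟩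
    ⅔ W        ∎))
    where open ≤-Reasoning

_◃_ : ∀ {a} {A : Set a} → A → (ℕ → A) → ℕ → A
(x ◃ f) zero = x
(x ◃ f) (suc i) = f i

module Graphs (G : Graph n) where

  adjacent? : ∀ u v → Dec (Adjacent G u v)
  adjacent? u v = Adj G u v ≟ᵇ true

  adjacent-sym : ∀ {u v} → Adjacent G u v → Adjacent G v u
  adjacent-sym {u} {v} u~v = trans (Graph.sym G v u) u~v

  adjacent-irrefl : ∀ {u} → ¬ Adjacent G u u
  adjacent-irrefl {u} u~u with trans (sym (Graph.irrefl G u)) u~u
  ... | ()

  nbhd : Fin n → Subset n
  nbhd u = select (adjacent? u)

  neighbours : Subset n → Subset n
  neighbours X = select (λ u → nonempty? (X ∩ nbhd u))

  ∈-neighbours⁺ : ∀ {X a u} → a ∈ X → Adjacent G a u → u ∈ neighbours X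
  ∈-neighbours⁺ a∈X a~u = ∈-select⁺ (_ , x∈p∩q⁺ (a∈X , ∈-select⁺ (adjacent-sym a~u)))

  ∈-neighbours⁻ : ∀ {X u} → u ∈ neighbours X → ∃[ a ] a ∈ X × Adjacent G a u
  ∈-neighbours⁻ {X} {u} u∈ with ∈-select⁻ u∈
  ... | a , a∈ with x∈p∩q⁻ X (nbhd u) a∈
  ...   | a∈X , a∈nbhd = a , a∈X , adjacent-sym (∈-select⁻ a∈nbhd)

  Closed : (Fin n → Set) → Subset n → Set
  Closed B C = ∀ {u v} → u ∈ C → Adjacent G u v → v ∈ C ⊎ B v

  path-exit : ∀ {B C} → Closed B C → ∀ m (p : Fin (suc m) → Fin n) →
    (∀ i → Adjacent G (p (inject₁ i)) (p (F.suc i))) → p F.zero ∈ C → p (fromℕ m) ∉ C → ∃[ i ] B (p i)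
  path-exit closed zero p edges p₀∈C pₘ∉C = ⊥-elim (pₘ∉C p₀∈C)
  path-exit closed (suc m) p edges p₀∈C pₘ∉C with closed p₀∈C (edges F.zero)
  ... | inj₂ b = F.suc F.zero , b
  ... | inj₁ p₁∈C with path-exit closed m (λ i → p (F.suc i)) (λ i → edges (F.suc i)) p₁∈C pₘ∉C
  ...   | i , b = F.suc i , b

  ─-closed : ∀ {C D} → Closed (_∉ D) C → Closed (_∉ D) (D ─ C)
  ─-closed {C} {D} closed {u} {v} u∈D─C u~v with v ∈? D | v ∈? C
  ... | no v∉D | _ = inj₂ v∉D
  ... | yes v∈D | no v∉C = inj₁ (x∈p∧x∉q⇒x∈p─q v∈D v∉C)
  ... | yes _ | yes v∈C with closed v∈C (adjacent-sym u~v)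
  ...   | inj₁ u∈C = ⊥-elim (x∈p─q⇒x∉q D C u∈D─C u∈C)
  ...   | inj₂ u∉D = ⊥-elim (u∉D (p─q⊆p D C u∈D─C))

  record Disconnected (D : Subset n) : Set where
    field
      part : Subset n
      part⊆D : part ⊆ D
      part-closed : Closed (_∉ D) part
      part-nonempty : Nonempty part
      rest-nonempty : Nonempty (D ─ part)

  record InducedPath (t : ℕ) (p : ℕ → Fin n) : Set where
    field
      step : ∀ {i} → i ℕ.< t → Adjacent G (p i) (p (suc i))
      chordless : ∀ {i j} → suc i ℕ.< j → j ℕ.≤ t → ¬ Adjacent G (p i) (p j)
      distinct : ∀ {i j} → i ℕ.< j → j ℕ.≤ t → p i ≢ p j

  shorten : ∀ {r t p} → r ℕ.≤ t → InducedPath t p → InducedPath r p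
  shorten r≤t π = record
    { step = λ i<r → step (ℕ.<-≤-trans i<r r≤t)
    ; chordless = λ i+1<j j≤r → chordless i+1<j (ℕ.≤-trans j≤r r≤t)
    ; distinct = λ i<j j≤r → distinct i<j (ℕ.≤-trans j≤r r≤t)
    }
    where open InducedPath π

  module Ball (D : Subset n) {v : Fin n} (v∈D : v ∈ D) where

    ball : ℕ → Subset n
    ball zero = ⁅ v ⁆
    ball (suc i) = ball i ∪ (D ∩ neighbours (ball i))

    ball-grows : ∀ i → ball i ⊆ ball (suc i)
    ball-grows i = p⊆p∪q _

    ball-mono : ∀ {i j} → i ℕ.≤ j → ball i ⊆ ball j
    ball-mono = increasing⇒monotone ball ball-grows

    ball⊆D : ∀ i → ball i ⊆ D
    ball⊆D zero u∈ = subst (_∈ D) (sym (x∈⁅y⁆⇒x≡y v u∈)) v∈D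
    ball⊆D (suc i) u∈ with x∈p∪q⁻ (ball i) _ u∈
    ... | inj₁ u∈ball = ball⊆D i u∈ball
    ... | inj₂ u∈D∩N = proj₁ (x∈p∩q⁻ D _ u∈D∩N)

    ball-step : ∀ i {a u} → a ∈ ball i → u ∈ D → Adjacent G a u → u ∈ ball (suc i)
    ball-step i a∈ u∈D a~u = x∈p∪q⁺ (inj₂ (x∈p∩q⁺ (u∈D , ∈-neighbours⁺ a∈ a~u)))

    ball-parent : ∀ i {u} → u ∈ ball (suc i) → u ∉ ball i → ∃[ a ] a ∈ ball i × Adjacent G a u
    ball-parent i u∈ u∉ with x∈p∪q⁻ (ball i) _ u∈
    ... | inj₁ u∈ball = ⊥-elim (u∉ u∈ball)
    ... | inj₂ u∈D∩N = ∈-neighbours⁻ (proj₂ (x∈p∩q⁻ D _ u∈D∩N))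

    ball-closed : ∃[ j ] Closed (_∉ D) (ball j)
    ball-closed with increasing-stabilises ball ball-grows
    ... | j , stable = j , closed
      where
      closed : Closed (_∉ D) (ball j)
      closed {u} {u′} u∈ u~u′ with u′ ∈? D
      ... | yes u′∈D = inj₁ (stable (ball-step j u∈ u′∈D u~u′))
      ... | no u′∉D = inj₂ u′∉D

    AtDistance : ℕ → Fin n → Set
    AtDistance zero u = u ∈ ball zero
    AtDistance (suc i) u = u ∈ ball (suc i) × u ∉ ball i

    closer-parent : ∀ {t u} → AtDistance (suc t) u → ∃[ a ] AtDistance t a × Adjacent G a u
    closer-parent {t} {u} (u∈ , u∉) with ball-parent t u∈ u∉
    ... | a , a∈ , a~u = a , exact t a∈ u∉ , a~u
      where
      exact : ∀ s → a ∈ ball s → u ∉ ball s → AtDistance s a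
      exact zero a∈ _ = a∈
      exact (suc s) a∈ u∉ = a∈ , λ a∈′ → u∉ (ball-step s a∈′ (ball⊆D (suc t) u∈) a~u)

    record Geodesic (t : ℕ) (u : Fin n) : Set where
      field
        vertex : ℕ → Fin n
        starts : vertex 0 ≡ u
        ends : vertex t ≡ v
        layered : ∀ {i} → i ℕ.≤ t → vertex i ∈ ball (t ∸ i)
        induced : InducedPath t vertex

    geodesic : ∀ t {u} → AtDistance t u → Geodesic t u
    geodesic zero {u} u∈ = record
      { vertex = λ _ → u ; starts = refl ; ends = x∈⁅y⁆⇒x≡y v u∈
      ; layered = λ { z≤n → u∈ }
      ; induced = record { step = λ () ; chordless = λ { () z≤n } ; distinct = λ { () z≤n } } }
    geodesic (suc t) {u} (u∈ , u∉) with closer-parent (u∈ , u∉)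
    ... | a , a-at , a~u = record
      { vertex = u ◃ vertex
      ; starts = refl
      ; ends = ends
      ; layered = λ { {zero} _ → u∈ ; {suc i} (s≤s i≤t) → layered i≤t }
      ; induced = record { step = step′ ; chordless = chordless′ ; distinct = distinct′ } }
      where
      open Geodesic (geodesic t a-at)
      open InducedPath induced

      step′ : ∀ {i} → i ℕ.< suc t → Adjacent G ((u ◃ vertex) i) ((u ◃ vertex) (suc i))
      step′ {zero} _ = subst (Adjacent G u) (sym starts) (adjacent-sym a~u)
      step′ {suc i} (s≤s i<t) = step i<t

      chordless′ : ∀ {i j} → suc i ℕ.< j → j ℕ.≤ suc t → ¬ Adjacent G ((u ◃ vertex) i) ((u ◃ vertex) j)
      chordless′ {zero} {suc zero} (s≤s ()) _
      chordless′ {zero} {suc (suc j)} _ (s≤s j<t) u~ =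
        u∉ (ball-mono (ℕ.∸-monoʳ-< (s≤s z≤n) j<t)
                      (ball-step (t ∸ suc j) (layered j<t) (ball⊆D (suc t) u∈) (adjacent-sym u~)))
      chordless′ {suc i} {suc j} (s≤s i+1<j) (s≤s j≤t) = chordless i+1<j j≤t

      distinct′ : ∀ {i j} → i ℕ.< j → j ℕ.≤ suc t → (u ◃ vertex) i ≢ (u ◃ vertex) j
      distinct′ {zero} {suc j} _ (s≤s j≤t) u≡ =
        u∉ (ball-mono (ℕ.m∸n≤m t j) (subst (_∈ ball (t ∸ j)) (sym u≡) (layered j≤t)))
      distinct′ {suc i} {suc j} (s≤s i<j) (s≤s j≤t) = distinct i<j j≤t

  record ChordlessCycle (L : ℕ) (g : ℕ → Fin n) : Set where
    field
      long : 3 ℕ.≤ L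
      step : ∀ {i} → i ℕ.< L → Adjacent G (g i) (g (suc i))
      closing : Adjacent G (g L) (g 0)
      chordless : ∀ {i j} → suc i ℕ.< j → j ℕ.≤ L → (i ≡ 0 → j ≢ L) → ¬ Adjacent G (g i) (g j)
      distinct : ∀ {i j} → i ℕ.< j → j ℕ.≤ L → g i ≢ g j

  chordlessCycle⇒inducedCycle : ∀ {S L g} → ChordlessCycle L g → (∀ {i} → i ℕ.≤ L → g i ∉ S) →
    InducedCycleAvoiding G S (suc L) (λ i → g (toℕ i))
  chordlessCycle⇒inducedCycle {S} {L} {g} γ avoids =
    s≤s long , injective , (λ i → avoids (FP.toℕ≤pred[n] i)) ,
    λ i j → mk⇔ (adjacent⇒next (FP.toℕ≤pred[n] i) (FP.toℕ≤pred[n] j))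
                (next⇒adjacent (FP.toℕ≤pred[n] i) (FP.toℕ≤pred[n] j))
    where
    open ChordlessCycle γ

    Next : ℕ → ℕ → Set
    Next a b = b ≡ suc a % suc L

    injective : ∀ {i j : Fin (suc L)} → g (toℕ i) ≡ g (toℕ j) → i ≡ j
    injective {i} {j} eq with ℕ.<-cmp (toℕ i) (toℕ j)
    ... | tri< i<j _ _ = ⊥-elim (distinct i<j (FP.toℕ≤pred[n] j) eq)
    ... | tri≈ _ i≡j _ = FP.toℕ-injective i≡j
    ... | tri> _ _ j<i = ⊥-elim (distinct j<i (FP.toℕ≤pred[n] i) (sym eq))

    next⇒adjacent′ : ∀ {a b} → a ℕ.≤ L → Next a b → Adjacent G (g a) (g b)
    next⇒adjacent′ {a} a≤L b≡ with ℕ.m≤n⇒m<n∨m≡n a≤L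
    ... | inj₁ a<L = subst (λ b → Adjacent G (g a) (g b)) (sym (trans b≡ (m<n⇒m%n≡m (s≤s a<L)))) (step a<L)
    ... | inj₂ a≡L = subst₂ (λ a b → Adjacent G (g a) (g b)) (sym a≡L)
                       (sym (trans b≡ (trans (cong (λ a → suc a % suc L) a≡L) (n%n≡0 (suc L))))) closing

    next⇒adjacent : ∀ {a b} → a ℕ.≤ L → b ℕ.≤ L → Next a b ⊎ Next b a → Adjacent G (g a) (g b)
    next⇒adjacent a≤L _ (inj₁ next) = next⇒adjacent′ a≤L next
    next⇒adjacent _ b≤L (inj₂ next) = adjacent-sym (next⇒adjacent′ b≤L next)

    forward : ∀ {a b} → a ℕ.< b → b ℕ.≤ L → Adjacent G (g a) (g b) → Next a b ⊎ Next b a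
    forward {a} {b} a<b b≤L a~b with ℕ.m≤n⇒m<n∨m≡n a<b | a ℕ.≟ 0 | b ℕ.≟ L
    ... | inj₂ refl | _ | _ = inj₁ (sym (m<n⇒m%n≡m (s≤s b≤L)))
    ... | inj₁ a+1<b | yes refl | yes refl = inj₂ (sym (n%n≡0 (suc L)))
    ... | inj₁ a+1<b | no a≢0 | _ = ⊥-elim (chordless a+1<b b≤L (λ a≡0 → ⊥-elim (a≢0 a≡0)) a~b)
    ... | inj₁ a+1<b | _ | no b≢L = ⊥-elim (chordless a+1<b b≤L (λ _ → b≢L) a~b)

    adjacent⇒next : ∀ {a b} → a ℕ.≤ L → b ℕ.≤ L → Adjacent G (g a) (g b) → Next a b ⊎ Next b a
    adjacent⇒next {a} {b} a≤L b≤L a~b with ℕ.<-cmp a b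
    ... | tri< a<b _ _ = forward a<b b≤L a~b
    ... | tri≈ _ refl _ = ⊥-elim (adjacent-irrefl a~b)
    ... | tri> _ _ b<a = swap (forward b<a a≤L (adjacent-sym a~b))

  close-path : ∀ {r q x y} → InducedPath r q → 1 ℕ.≤ r → Adjacent G y x →
    Adjacent G x (q 0) → (∀ {i} → 1 ℕ.≤ i → i ℕ.≤ r → ¬ Adjacent G x (q i)) →
    Adjacent G y (q r) → (∀ {i} → i ℕ.< r → ¬ Adjacent G y (q i)) →
    (∀ {i} → i ℕ.≤ r → x ≢ q i) → (∀ {i} → i ℕ.≤ r → y ≢ q i) →
    ChordlessCycle (suc (suc r)) (y ◃ (x ◃ q))
  close-path {r} {q} {x} {y} π 1≤r y~x x~q₀ x≁q y~qᵣ y≁q x∉q y∉q = record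
    { long = s≤s (s≤s 1≤r)
    ; step = step′
    ; closing = adjacent-sym y~qᵣ
    ; chordless = chordless′
    ; distinct = distinct′
    }
    where
    open InducedPath π
    g : ℕ → Fin n
    g = y ◃ (x ◃ q)

    step′ : ∀ {i} → i ℕ.< suc (suc r) → Adjacent G (g i) (g (suc i))
    step′ {zero} _ = y~x
    step′ {suc zero} _ = x~q₀
    step′ {suc (suc i)} (s≤s (s≤s i<r)) = step i<r

    chordless′ : ∀ {i j} → suc i ℕ.< j → j ℕ.≤ suc (suc r) → (i ≡ 0 → j ≢ suc (suc r)) → ¬ Adjacent G (g i) (g j)
    chordless′ {zero} {suc zero} (s≤s ()) _ _
    chordless′ {zero} {suc (suc j)} _ (s≤s (s≤s j≤r)) not-closing =
      y≁q (ℕ.≤∧≢⇒< j≤r (λ j≡r → not-closing refl (cong (λ k → suc (suc k)) j≡r)))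
    chordless′ {suc zero} {suc (suc j)} (s≤s (s≤s 1≤j)) (s≤s (s≤s j≤r)) _ = x≁q 1≤j j≤r
    chordless′ {suc (suc i)} {suc (suc j)} (s≤s (s≤s i+1<j)) (s≤s (s≤s j≤r)) _ = chordless i+1<j j≤r

    distinct′ : ∀ {i j} → i ℕ.< j → j ℕ.≤ suc (suc r) → g i ≢ g j
    distinct′ {zero} {suc zero} _ _ y≡x = adjacent-irrefl (subst (Adjacent G y) (sym y≡x) y~x)
    distinct′ {zero} {suc (suc j)} _ (s≤s (s≤s j≤r)) = y∉q j≤r
    distinct′ {suc zero} {suc zero} (s≤s ()) _
    distinct′ {suc zero} {suc (suc j)} _ (s≤s (s≤s j≤r)) = x∉q j≤r
    distinct′ {suc (suc i)} {suc (suc j)} (s≤s (s≤s i<j)) (s≤s (s≤s j≤r)) = distinct i<j j≤r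

module Cuts (G : Graph n) (S : Subset n) where
  open Graphs G

  Clique : Subset n → Set
  Clique K = ∀ {x y} → x ∈ K → y ∈ K → x ≢ y → Adjacent G x y

  -- D is a union of components of G - (S ∪ K)
  record CliqueCut (K D : Subset n) : Set where
    field
      clique : Clique K
      K-disjoint-S : ∀ {x} → x ∈ K → x ∉ S
      D-disjoint-S : ∀ {u} → u ∈ D → u ∉ S
      D-disjoint-K : ∀ {u} → u ∈ D → u ∉ K
      closed : Closed (λ u → u ∈ K ⊎ u ∈ S) D

  initial-cut : CliqueCut ⊥ (∁ S)
  initial-cut = record
    { clique = λ x∈⊥ → ⊥-elim (∉⊥ x∈⊥)
    ; K-disjoint-S = λ x∈⊥ → ⊥-elim (∉⊥ x∈⊥)
    ; D-disjoint-S = x∈∁p⇒x∉p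
    ; D-disjoint-K = λ _ → ∉⊥
    ; closed = closed
    }
    where
    closed : Closed (λ u → u ∈ ⊥ ⊎ u ∈ S) (∁ S)
    closed {v = v} _ _ with v ∈? S
    ... | yes v∈S = inj₂ (inj₂ v∈S)
    ... | no v∉S = inj₁ (x∉p⇒x∈∁p v∉S)

  trim : Subset n → Subset n → Subset n
  trim K D = select (λ x → x ∈? K ×-dec nonempty? (D ∩ nbhd x))

  trim-cut : ∀ {K D} → CliqueCut K D → CliqueCut (trim K D) D
  trim-cut {K} {D} cut = record
    { clique = λ x∈ y∈ → clique (in-K x∈) (in-K y∈)
    ; K-disjoint-S = λ x∈ → K-disjoint-S (in-K x∈)
    ; D-disjoint-S = D-disjoint-S
    ; D-disjoint-K = λ u∈D u∈ → D-disjoint-K u∈D (in-K u∈)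
    ; closed = closed′
    }
    where
    open CliqueCut cut
    in-K : ∀ {x} → x ∈ trim K D → x ∈ K
    in-K x∈ = proj₁ (∈-select⁻ x∈)
    closed′ : Closed (λ u → u ∈ trim K D ⊎ u ∈ S) D
    closed′ {u} {v} u∈D u~v with closed u∈D u~v
    ... | inj₁ v∈D = inj₁ v∈D
    ... | inj₂ (inj₂ v∈S) = inj₂ (inj₂ v∈S)
    ... | inj₂ (inj₁ v∈K) =
      inj₂ (inj₁ (∈-select⁺ (v∈K , u , x∈p∩q⁺ (u∈D , ∈-select⁺ (adjacent-sym u~v)))))

  restrict-cut : ∀ {K D C} → CliqueCut K D → C ⊆ D → Closed (_∉ D) C → CliqueCut K C
  restrict-cut {K} {D} {C} cut C⊆D C-closed = record
    { clique = clique
    ; K-disjoint-S = K-disjoint-S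
    ; D-disjoint-S = λ u∈C → D-disjoint-S (C⊆D u∈C)
    ; D-disjoint-K = λ u∈C → D-disjoint-K (C⊆D u∈C)
    ; closed = closed′
    }
    where
    open CliqueCut cut
    closed′ : Closed (λ u → u ∈ K ⊎ u ∈ S) C
    closed′ u∈C u~v with C-closed u∈C u~v
    ... | inj₁ v∈C = inj₁ v∈C
    ... | inj₂ v∉D with closed (C⊆D u∈C) u~v
    ...   | inj₁ v∈D = ⊥-elim (v∉D v∈D)
    ...   | inj₂ v∈K∪S = inj₂ v∈K∪S

  absorb-cut : ∀ {K D v} → CliqueCut K D → v ∈ D → K ⊆ nbhd v → CliqueCut (K ∪ ⁅ v ⁆) (D - v)
  absorb-cut {K} {D} {v} cut v∈D K⊆Nv = record
    { clique = clique′
    ; K-disjoint-S = [ K-disjoint-S , (λ { refl → D-disjoint-S v∈D }) ]′ ∘ cases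
    ; D-disjoint-S = λ u∈ → D-disjoint-S (p─q⊆p D _ u∈)
    ; D-disjoint-K = λ u∈ →
        [ D-disjoint-K (p─q⊆p D _ u∈) , (λ { refl → x∈p─q⇒x∉q D _ u∈ (x∈⁅x⁆ v) }) ]′ ∘ cases
    ; closed = closed′
    }
    where
    open CliqueCut cut
    cases : ∀ {x} → x ∈ K ∪ ⁅ v ⁆ → x ∈ K ⊎ x ≡ v
    cases x∈ = map₂ (x∈⁅y⁆⇒x≡y v) (x∈p∪q⁻ K ⁅ v ⁆ x∈)
    clique′ : Clique (K ∪ ⁅ v ⁆)
    clique′ x∈ y∈ x≢y with cases x∈ | cases y∈
    ... | inj₁ x∈K | inj₁ y∈K = clique x∈K y∈K x≢y
    ... | inj₁ x∈K | inj₂ refl = adjacent-sym (∈-select⁻ (K⊆Nv x∈K))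
    ... | inj₂ refl | inj₁ y∈K = ∈-select⁻ (K⊆Nv y∈K)
    ... | inj₂ refl | inj₂ refl = ⊥-elim (x≢y refl)
    closed′ : Closed (λ u → u ∈ K ∪ ⁅ v ⁆ ⊎ u ∈ S) (D - v)
    closed′ {u} {u′} u∈ u~u′ with closed (p─q⊆p D _ u∈) u~u′
    ... | inj₂ (inj₁ u′∈K) = inj₂ (inj₁ (p⊆p∪q _ u′∈K))
    ... | inj₂ (inj₂ u′∈S) = inj₂ (inj₂ u′∈S)
    ... | inj₁ u′∈D with u′ F.≟ v
    ...   | yes refl = inj₂ (inj₁ (q⊆p∪q K _ (x∈⁅x⁆ v)))
    ...   | no u′≢v = inj₁ (x∈p∧x≢y⇒x∈p-y u′∈D u′≢v)

  module _ (chordal : ChordalDeletionSet G S) where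

    module _ {K D v x} (cut : CliqueCut K D) (v∈D : v ∈ D) (x∈K : x ∈ K) (x∉Nv : x ∉ nbhd v) where
      open CliqueCut cut
      open Ball D v∈D

      module _ {t u} (γ : Geodesic t u) (x~u : Adjacent G x u)
               (x-far : ∀ {i} → i ℕ.< t → ¬ Nonempty (ball i ∩ nbhd x)) where
        open Geodesic γ

        vertex∈D : ∀ {i} → i ℕ.≤ t → vertex i ∈ D
        vertex∈D {i} i≤t = ball⊆D (t ∸ i) (layered i≤t)

        x≁vertex : ∀ {i} → 1 ℕ.≤ i → i ℕ.≤ t → ¬ Adjacent G x (vertex i)
        x≁vertex {i} 1≤i i≤t x~ =
          x-far (ℕ.∸-monoʳ-< 1≤i i≤t) (vertex i , x∈p∩q⁺ (layered i≤t , ∈-select⁺ x~))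

        adjacent-end : ∀ {y} → y ∈ nbhd v → Adjacent G y (vertex t)
        adjacent-end y∈Nv = subst (Adjacent G _) (sym ends) (adjacent-sym (∈-select⁻ y∈Nv))

        K∌vertex : ∀ {z i} → z ∈ K → i ℕ.≤ t → z ≢ vertex i
        K∌vertex z∈K i≤t refl = D-disjoint-K (vertex∈D i≤t) z∈K

        -- otherwise y, x and the path from u up to the first neighbour of y form a chordless cycle
        nearest-dominates : K ∩ nbhd v ⊆ nbhd u
        nearest-dominates {y} y∈ with x∈p∩q⁻ K (nbhd v) y∈ | y ∈? nbhd u
        ... | _ | yes y∈Nu = y∈Nu
        ... | y∈K , y∈Nv | no y∉Nu with least-witness (λ i → adjacent? y (vertex i)) (adjacent-end y∈Nv)
        ...   | zero , y~u , _ = ⊥-elim (y∉Nu (∈-select⁺ (adjacent-sym (subst (Adjacent G y) starts y~u))))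
        ...   | suc r , y~r , y≁below-r = ⊥-elim (chordal _ _ (chordlessCycle⇒inducedCycle cycle avoids))
          where
          r<t : suc r ℕ.≤ t
          r<t = ℕ.≮⇒≥ (λ t<r → y≁below-r t<r (adjacent-end y∈Nv))
          y≢x : y ≢ x
          y≢x refl = x∉Nv y∈Nv
          cycle : ChordlessCycle (3 ℕ.+ r) (y ◃ (x ◃ vertex))
          cycle = close-path (shorten r<t (Geodesic.induced γ)) (s≤s z≤n) (clique y∈K x∈K y≢x)
            (subst (Adjacent G x) (sym starts) x~u) (λ 1≤i i≤r → x≁vertex 1≤i (ℕ.≤-trans i≤r r<t))
            y~r y≁below-r (λ i≤r → K∌vertex x∈K (ℕ.≤-trans i≤r r<t))
            (λ i≤r → K∌vertex y∈K (ℕ.≤-trans i≤r r<t))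
          avoids : ∀ {i} → i ℕ.≤ 3 ℕ.+ r → (y ◃ (x ◃ vertex)) i ∉ S
          avoids {zero} _ = K-disjoint-S y∈K
          avoids {suc zero} _ = K-disjoint-S x∈K
          avoids {suc (suc i)} (s≤s (s≤s i≤r)) = D-disjoint-S (vertex∈D (ℕ.≤-trans i≤r r<t))

      nearer-neighbour : Nonempty (D ∩ nbhd x) →
        Disconnected D ⊎ ∃[ u ] u ∈ D × x ∈ nbhd u × K ∩ nbhd v ⊆ nbhd u
      nearer-neighbour (u₀ , u₀∈) with ball-closed | x∈p∩q⁻ D (nbhd x) u₀∈
      ... | j , ball-j-closed | u₀∈D , u₀∈Nx with u₀ ∈? ball j
      ... | no u₀∉ball = inj₁ (record
        { part = ball j
        ; part⊆D = ball⊆D j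
        ; part-closed = ball-j-closed
        ; part-nonempty = v , ball-mono {j = j} z≤n (x∈⁅x⁆ v)
        ; rest-nonempty = u₀ , x∈p∧x∉q⇒x∈p─q u₀∈D u₀∉ball
        })
      ... | yes u₀∈ball
          with least-witness (λ i → nonempty? (ball i ∩ nbhd x)) {j} (u₀ , x∈p∩q⁺ (u₀∈ball , u₀∈Nx))
      ...   | t , (u , u∈) , x-far with x∈p∩q⁻ (ball t) (nbhd x) u∈
      ...     | u∈ball , u∈Nx = inj₂ (u , ball⊆D t u∈ball , ∈-select⁺ (adjacent-sym x~u) ,
                                     nearest-dominates (geodesic t (at-distance t ℕ.≤-refl u∈ball)) x~u x-far)
        where
        x~u : Adjacent G x u
        x~u = ∈-select⁻ u∈Nx
        at-distance : ∀ s → s ℕ.≤ t → u ∈ ball s → AtDistance s u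
        at-distance zero _ u∈ball = u∈ball
        at-distance (suc s) s<t u∈ball = u∈ball , λ u∈ball′ → x-far s<t (u , x∈p∩q⁺ (u∈ball′ , u∈Nx))

    universal-vertex : ∀ {K D v} → CliqueCut K D → (∀ {x} → x ∈ K → Nonempty (D ∩ nbhd x)) → v ∈ D →
      Disconnected D ⊎ ∃[ u ] u ∈ D × K ⊆ nbhd u
    universal-vertex {K} {D} {v} cut attached = go (⊃-wellFounded (K ∩ nbhd v))
      where
      go : ∀ {v} → Acc _⊃_ (K ∩ nbhd v) → v ∈ D → Disconnected D ⊎ ∃[ u ] u ∈ D × K ⊆ nbhd u
      go {v} (acc larger) v∈D with K ⊆? nbhd v
      ... | yes K⊆Nv = inj₂ (v , v∈D , K⊆Nv)
      ... | no K⊈Nv with ⊈⇒witness K⊈Nv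
      ...   | x , x∈K , x∉Nv with nearer-neighbour cut v∈D x∈K x∉Nv (attached x∈K)
      ...     | inj₁ disconnected = inj₁ disconnected
      ...     | inj₂ (u , u∈D , x∈Nu , dominates) = go (larger more-neighbours) u∈D
        where
        more-neighbours : K ∩ nbhd v ⊂ K ∩ nbhd u
        more-neighbours = (λ y∈ → x∈p∩q⁺ (proj₁ (x∈p∩q⁻ K _ y∈) , dominates y∈)) ,
                          x , x∈p∩q⁺ (x∈K , x∈Nu) , λ x∈′ → x∉Nv (proj₂ (x∈p∩q⁻ K _ x∈′))

    decompose : ∀ {K D} → CliqueCut K D → Nonempty D → Disconnected D ⊎ ∃[ v ] v ∈ D × trim K D ⊆ nbhd v
    decompose cut (v , v∈D) = universal-vertex (trim-cut cut) (λ x∈ → proj₂ (∈-select⁻ x∈)) v∈D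

module Balance (G : Graph n) (S : Subset n) (chordal : ChordalDeletionSet G S)
               (w : Fin n → ℚ) (w≥0 : ∀ v → 0ℚ ≤ w v) where
  open Graphs G
  open Cuts G S
  open import Data.Rational using (_+_)
  open import Data.Rational.Properties
    using (≤-trans; ≤-refl; <-irrefl; <⇒≤; +-comm; +-mono-≤; _<?_; ≮⇒≥; ≤-total; module ≤-Reasoning)

  W : ℚ
  W = weight w ⊤

  BalancedSeparation : Set
  BalancedSeparation = Σ (Subset n) λ A → Σ (Subset n) λ B →
    IsSeparation G A B × Balanced (+ 2 / 3) w A B × IsSemiClique 1 ∣ S ∣ G (A ∩ B)

  separation : ∀ {K P} → CliqueCut K P → weight w P ≤ ⅔ W → ⅓ W ≤ weight w (S ∪ K ∪ P) → BalancedSeparation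
  separation {K} {P} cut P-light A-heavy = A , B , (cover , separates) , (A─B-light , B─A-light) , semi-clique
    where
    open CliqueCut cut
    A B : Subset n
    A = S ∪ K ∪ P
    B = ∁ P

    P⊆A : P ⊆ A
    P⊆A u∈P = q⊆p∪q S _ (q⊆p∪q K P u∈P)

    boundary⊆A∩B : ∀ {u} → u ∈ K ⊎ u ∈ S → u ∈ A ∩ B
    boundary⊆A∩B (inj₁ u∈K) = x∈p∩q⁺ (q⊆p∪q S _ (p⊆p∪q P u∈K) , x∉p⇒x∈∁p (λ u∈P → D-disjoint-K u∈P u∈K))
    boundary⊆A∩B (inj₂ u∈S) = x∈p∩q⁺ (p⊆p∪q (K ∪ P) u∈S , x∉p⇒x∈∁p (λ u∈P → D-disjoint-S u∈P u∈S))

    A∩B⊆boundary : ∀ {u} → u ∈ A ∩ B → u ∈ K ⊎ u ∈ S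
    A∩B⊆boundary u∈A∩B with x∈p∩q⁻ A B u∈A∩B
    ... | u∈A , u∈B with x∈p∪q⁻ S (K ∪ P) u∈A
    ...   | inj₁ u∈S = inj₂ u∈S
    ...   | inj₂ u∈K∪P with x∈p∪q⁻ K P u∈K∪P
    ...     | inj₁ u∈K = inj₁ u∈K
    ...     | inj₂ u∈P = ⊥-elim (x∈∁p⇒x∉p u∈B u∈P)

    A─B⊆P : A ─ B ⊆ P
    A─B⊆P u∈ = x∉∁p⇒x∈p (x∈p─q⇒x∉q A B u∈)

    cover : ∀ u → u ∈ A ⊎ u ∈ B
    cover u with u ∈? P
    ... | yes u∈P = inj₁ (P⊆A u∈P)
    ... | no u∉P = inj₂ (x∉p⇒x∈∁p u∉P)

    separates : Separates G (A ∩ B) (A ─ B) (B ─ A)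
    separates m p (_ , edges) p₀∈ pₘ∈ with path-exit closed m p edges (A─B⊆P p₀∈) (x∈p─q⇒x∉q B A pₘ∈ ∘ P⊆A)
    ... | i , pᵢ∈ = i , boundary⊆A∩B pᵢ∈

    A─B-light : weight w (A ─ B) ≤ ⅔ W
    A─B-light = ≤-trans (weight-mono w w≥0 A─B⊆P) P-light

    B─A-light : weight w (B ─ A) ≤ ⅔ W
    B─A-light = below-⅔-beside-⅓ W (begin
      weight w (B ─ A) + weight w A   ≤⟨ +-mono-≤ (weight-mono w w≥0 B─A⊆⊤─A) ≤-refl ⟩
      weight w (⊤ ─ A) + weight w A   ≡⟨ +-comm (weight w (⊤ ─ A)) (weight w A) ⟩
      weight w A + weight w (⊤ ─ A)   ≡⟨ sym (weight-─ w ⊆⊤) ⟩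
      W                               ∎) A-heavy
      where
      open ≤-Reasoning
      B─A⊆⊤─A : B ─ A ⊆ ⊤ ─ A
      B─A⊆⊤─A u∈ = x∈p∧x∉q⇒x∈p─q ∈⊤ (x∈p─q⇒x∉q B A u∈)

    semi-clique : IsSemiClique 1 ∣ S ∣ G (A ∩ B)
    semi-clique = K , S , (λ u → mk⇔ A∩B⊆boundary boundary⊆A∩B) , (λ u → K-disjoint-S) ,
      ((λ _ → F.zero) , λ u v u∈K v∈K u≢v → mk⇔ (λ _ → refl) (λ _ → clique u∈K v∈K u≢v)) , ℕ.≤-refl

  W≥0 : 0ℚ ≤ W
  W≥0 = weight-nonneg w w≥0 ⊤

  heavy⇒nonempty : ∀ {D} → ⅔ W < weight w D → Nonempty D
  heavy⇒nonempty {D} heavy with nonempty? D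
  ... | yes nonempty = nonempty
  ... | no empty = ⊥-elim (<-irrefl refl (begin-strict
    ⅔ W              <⟨ heavy ⟩
    weight w D       ≡⟨ cong (weight w) (Empty-unique empty) ⟩
    weight w ⊥       ≡⟨ weight-⊥ w ⟩
    0ℚ               ≤⟨ ≤-trans (⅓-nonneg W≥0) (⅓≤⅔ W≥0) ⟩
    ⅔ W              ∎))
    where open ≤-Reasoning

  record Progress (D : Subset n) : Set where
    field
      K₁ D₁ : Subset n
      cut₁ : CliqueCut K₁ D₁
      D₁⊂D : D₁ ⊂ D
      side-heavy : ⅓ W ≤ weight w (S ∪ K₁ ∪ D₁)

  heavy-part-progress : ∀ {K D P} → CliqueCut K P → P ⊂ D → ⅓ W ≤ weight w P → Progress D
  heavy-part-progress {K} {D} {P} cut P⊂D P-heavy = record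
    { K₁ = K ; D₁ = P ; cut₁ = cut ; D₁⊂D = P⊂D
    ; side-heavy = ≤-trans P-heavy (weight-mono w w≥0 (q⊆p∪q S _ ∘ q⊆p∪q K P)) }

  split-progress : ∀ {K D} → CliqueCut K D → ⅔ W < weight w D → Disconnected D → Progress D
  split-progress {K} {D} cut heavy
    record { part = C ; part⊆D = C⊆D ; part-closed = C-closed
           ; part-nonempty = c , c∈C ; rest-nonempty = d , d∈D─C } =
    heavier (≤-total (weight w C) (weight w (D ─ C)))
    where
    heavy′ : ⅔ W < weight w C + weight w (D ─ C)
    heavy′ = subst (⅔ W <_) (weight-─ w C⊆D) heavy
    C⊂D : C ⊂ D
    C⊂D = C⊆D , d , p─q⊆p D C d∈D─C , x∈p─q⇒x∉q D C d∈D─C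
    D─C⊂D : D ─ C ⊂ D
    D─C⊂D = p─q⊆p D C , c , C⊆D c∈C , λ c∈D─C → x∈p─q⇒x∉q D C c∈D─C c∈C
    heavier : weight w C ≤ weight w (D ─ C) ⊎ weight w (D ─ C) ≤ weight w C → Progress D
    heavier (inj₁ C≤D─C) =
      heavy-part-progress (restrict-cut cut (p─q⊆p D C) (─-closed C-closed)) D─C⊂D
        (heavier-part W (subst (⅔ W <_) (+-comm (weight w C) _) heavy′) C≤D─C)
    heavier (inj₂ D─C≤C) =
      heavy-part-progress (restrict-cut cut C⊆D C-closed) C⊂D (heavier-part W heavy′ D─C≤C)

  progress : ∀ {K D} → CliqueCut K D → ⅔ W < weight w D → Progress D
  progress {K} {D} cut heavy with decompose chordal cut (heavy⇒nonempty heavy)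
  ... | inj₁ disconnected = split-progress cut heavy disconnected
  ... | inj₂ (v , v∈D , trim⊆Nv) = record
    { K₁ = trim K D ∪ ⁅ v ⁆ ; D₁ = D - v ; cut₁ = absorb-cut (trim-cut cut) v∈D trim⊆Nv
    ; D₁⊂D = x∈p⇒p-x⊂p v∈D
    ; side-heavy = begin
        ⅓ W                                    ≤⟨ ⅓≤⅔ W≥0 ⟩
        ⅔ W                                    ≤⟨ <⇒≤ heavy ⟩
        weight w D                             ≤⟨ weight-mono w w≥0 D⊆side ⟩
        weight w (S ∪ (trim K D ∪ ⁅ v ⁆) ∪ (D - v)) ∎ }
    where
    open ≤-Reasoning
    D⊆side : D ⊆ S ∪ (trim K D ∪ ⁅ v ⁆) ∪ (D - v)
    D⊆side {u} u∈D with u F.≟ v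
    ... | yes refl = q⊆p∪q S _ (p⊆p∪q _ (q⊆p∪q (trim K D) _ (x∈⁅x⁆ v)))
    ... | no u≢v = q⊆p∪q S _ (q⊆p∪q _ _ (x∈p∧x≢y⇒x∈p-y u∈D u≢v))

  separation-from : ∀ {K D} → Acc _⊂_ D → CliqueCut K D → ⅓ W ≤ weight w (S ∪ K ∪ D) → BalancedSeparation
  separation-from {K} {D} (acc smaller) cut side-heavy with ⅔ W <? weight w D
  ... | no D-light = separation cut (≮⇒≥ D-light) side-heavy
  ... | yes D-heavy = separation-from (smaller D₁⊂D) cut₁ (Progress.side-heavy next)
    where
    next : Progress D
    next = progress cut D-heavy
    open Progress next using (D₁⊂D; cut₁)

  balanced-separation : BalancedSeparation
  balanced-separation =
    separation-from (⊂-wellFounded (∁ S)) initial-cut (≤-trans (⅓≤id W≥0) (weight-mono w w≥0 ⊤⊆side))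
    where
    ⊤⊆side : ⊤ ⊆ S ∪ ⊥ ∪ ∁ S
    ⊤⊆side {u} _ with u ∈? S
    ... | yes u∈S = p⊆p∪q _ u∈S
    ... | no u∉S = q⊆p∪q S _ (q⊆p∪q ⊥ _ (x∉p⇒x∈∁p u∉S))

lemma3p3 : ∀ {n} (G : Graph n) (k : ℕ) (S : Subset n) → ChordalDeletionSet G S → ∣ S ∣ ≡ k →
    (w : Fin n → ℚ) → (∀ v → 0ℚ ≤ w v) →
    Σ (Subset n) λ A → Σ (Subset n) λ B →
      IsSeparation G A B × Balanced ((+ 2) / 3) w A B × IsSemiClique 1 k G (A ∩ B)
lemma3p3 G k S chordal refl w w≥0 = Balance.balanced-separation G S chordal w w≥0
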